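{- For $N\in\mathbb{N}$, \begin{equation*} \sum_{n=1}^{N}\left[\begin{matrix} N \\ n\end{matrix}\right]\frac{(-1)^{n-1}a^nq^\frac{n(n+1)}{2}(q)_n}{(1-q^n)(aq)_n}=\sum_{n=1}^{N}\frac{aq^n}{1-aq^n}. \end{equation*}
   Context: $|q|<1$; $(a)_n=(a;q)_n=(1-a)(1-aq)\cdots(1-aq^{n-1})$ with $(a)_0=1$. The $q$-binomial coefficient is $\left[\begin{matrix} N \\ n\end{matrix}\right]=\frac{(q)_N}{(q)_n(q)_{N-n}}$ for $0\le n\le N$ and $0$ otherwise. $a$ is complex with all denominators nonzero. -}

module Defs where

open import Level using (_⊔_) renaming (suc to lsuc)
open import Algebra.Bundles using (CommutativeRing)
open import Data.Nat as ℕ using (ℕ; zero; suc)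
import Data.Nat.DivMod as ℕD
open import Relation.Nullary using (¬_; yes; no)

-- A field: a commutative ring with 1 ≉ 0 and a (total) inverse function
-- which is a multiplicative inverse on nonzero elements
-- (the value of 0⁻¹ is irrelevant; all denominators are assumed nonzero).
record Field c ℓ : Set (lsuc (c ⊔ ℓ)) where
  field
    commutativeRing : CommutativeRing c ℓ
  open CommutativeRing commutativeRing public
  field
    _⁻¹       : Carrier → Carrier
    ⁻¹-cong   : ∀ {x y} → x ≈ y → x ⁻¹ ≈ y ⁻¹
    inverseʳ  : ∀ x → ¬ (x ≈ 0#) → x * (x ⁻¹) ≈ 1#
    1≉0       : ¬ (1# ≈ 0#)

  infixl 7 _/_
  _/_ : Carrier → Carrier → Carrier
  x / y = x * (y ⁻¹)

module QDefs {c ℓ} (F : Field c ℓ) where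
  open Field F

  pow : Carrier → ℕ → Carrier
  pow x zero    = 1#
  pow x (suc n) = pow x n * x

  poch : Carrier → Carrier → ℕ → Carrier
  poch a q zero    = 1#
  poch a q (suc n) = poch a q n * (1# - a * pow q n)

  qbinom : Carrier → ℕ → ℕ → Carrier
  qbinom q N n with n ℕ.≤? N
  ... | yes _ = poch q q N / (poch q q n * poch q q (N ℕ.∸ n))
  ... | no  _ = 0#

  sum1 : ℕ → (ℕ → Carrier) → Carrier
  sum1 zero    f = 0#
  sum1 (suc N) f = sum1 N f + f (suc N)

  tri : ℕ → ℕ
  tri n = (n ℕ.* suc n) ℕD./ 2

-- Writing [N n](q)_n = (1 - q^N)⋯(1 - q^(N-n+1)), the q-Pascal rule
-- [N+1 n] = [N n] + q^(N+1-n) [N n-1] splits each summand for N+1 into the summand for N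
-- and a correction term, and the summand for N at n = N+1 vanishes.  The correction terms
-- telescope: with Q = q^(N+1) and w_k = (-1)^(k-1) a^k q^(k(k+1)/2), their first k sum to
-- aQ/(1 - aQ) · (1 + w_k [N k](q)_k/(aq)_k), which for k = N+1 is aQ/(1 - aQ), the new term
-- on the right.

module Submission where

open import Defs
open import Level using (Level)
open import Data.Nat using (ℕ; _≤_; _∸_)
open import Relation.Nullary using (¬_)

open import Algebra.Bundles using (CommutativeRing; RawRing)
import Data.Nat as Nat
open Nat using (zero; suc; _<_; z≤n; s≤s; s≤s⁻¹)
open import Data.Nat.Properties using (≤-refl; ≤-trans; m≤n⇒m≤1+n; n≤1+n; m∸n≤m; <⇒≤; m∸n+n≡m; +-∸-assoc; n∸n≡0)
open import Data.Nat.Divisibility using (divides-refl)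
import Data.Nat.DivMod as Nat
open import Data.Nat.Tactic.RingSolver using (solve-∀)
open import Data.Product as Product using (_,_; swap)
open import Data.Product.Properties using (≡-dec)
open import Data.Maybe using (map)
open import Relation.Binary.Consequences using (dec⇒weaklyDec)
open import Relation.Binary.PropositionalEquality as ≡ using (_≡_; cong)
open import Relation.Nullary using (yes; no; contradiction)

-- An integer m - n is represented by the pair (m , n) with m = 0 or n = 0; these normal
-- forms make the solver's comparison of coefficients syntactic.
ℕ² : Set
ℕ² = ℕ Product.× ℕ

module IntegerCoefficientRingSolver {c ℓ} (R : CommutativeRing c ℓ) where
  open CommutativeRing R
  open import Algebra.Properties.Ring ring
    using (-‿+-comm; -0#≈0#; ⁻¹-anti-homo‿-; x[y-z]≈xy-xz; [y-z]x≈yx-zx)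
  open import Algebra.Properties.CommutativeSemigroup +-commutativeSemigroup using (interchange)
  open import Algebra.Properties.Semiring.Mult.TCOptimised semiring using (_×_; 1+×; ×-homo-+; ×1-homo-*)
  open import Algebra.Solver.Ring.AlmostCommutativeRing
    using (fromCommutativeRing; _-Raw-AlmostCommutative⟶_)
  open import Relation.Binary.Reasoning.Setoid setoid

  normalise : ℕ → ℕ → ℕ²
  normalise m n = m Nat.∸ n , n Nat.∸ m

  coefficients : RawRing _ _
  coefficients = record
    { Carrier = ℕ²
    ; _≈_     = _≡_
    ; _+_     = λ (m , n) (m′ , n′) → normalise (m Nat.+ m′) (n Nat.+ n′)
    ; _*_     = λ (m , n) (m′ , n′) → normalise (m Nat.* m′ Nat.+ n Nat.* n′) (m Nat.* n′ Nat.+ n Nat.* m′)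
    ; -_      = swap
    ; 0#      = 0 , 0
    ; 1#      = 1 , 0
    }

  ⟦_⟧ : ℕ² → Carrier
  ⟦ m , zero  ⟧ = m × 1#
  ⟦ m , suc n ⟧ = m × 1# - suc n × 1#

  ⟦,⟧ : ∀ m n → ⟦ m , n ⟧ ≈ m × 1# - n × 1#
  ⟦,⟧ m zero    = sym (trans (+-congˡ -0#≈0#) (+-identityʳ _))
  ⟦,⟧ m (suc n) = refl

  [x+y]-[u+v] : ∀ x y u v → (x + y) - (u + v) ≈ (x - u) + (y - v)
  [x+y]-[u+v] x y u v = begin
    (x + y) - (u + v)     ≈⟨ +-congˡ (-‿+-comm u v) ⟨
    (x + y) + (- u + - v) ≈⟨ interchange x y (- u) (- v) ⟩
    (x - u) + (y - v)     ∎

  [x-y]*[u-v] : ∀ x y u v → (x - y) * (u - v) ≈ (x * u + y * v) - (x * v + y * u)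
  [x-y]*[u-v] x y u v = begin
    (x - y) * (u - v)                      ≈⟨ [y-z]x≈yx-zx (u - v) x y ⟩
    x * (u - v) - y * (u - v)              ≈⟨ +-cong (x[y-z]≈xy-xz x u v) (-‿cong (x[y-z]≈xy-xz y u v)) ⟩
    (x * u - x * v) - (y * u - y * v)      ≈⟨ +-congˡ (⁻¹-anti-homo‿- (y * u) (y * v)) ⟩
    (x * u - x * v) + (y * v - y * u)      ≈⟨ [x+y]-[u+v] (x * u) (y * v) (x * v) (y * u) ⟨
    (x * u + y * v) - (x * v + y * u)      ∎

  ⟦normalise⟧ : ∀ m n → ⟦ normalise m n ⟧ ≈ m × 1# - n × 1#
  ⟦normalise⟧ zero    zero    = ⟦,⟧ 0 0
  ⟦normalise⟧ zero    (suc n) = refl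
  ⟦normalise⟧ (suc m) zero    = ⟦,⟧ (suc m) 0
  ⟦normalise⟧ (suc m) (suc n) = begin
    ⟦ normalise m n ⟧                ≈⟨ ⟦normalise⟧ m n ⟩
    m × 1# - n × 1#                  ≈⟨ +-identityˡ _ ⟨
    0# + (m × 1# - n × 1#)           ≈⟨ +-congʳ (-‿inverseʳ 1#) ⟨
    (1# - 1#) + (m × 1# - n × 1#)    ≈⟨ [x+y]-[u+v] 1# (m × 1#) 1# (n × 1#) ⟨
    (1# + m × 1#) - (1# + n × 1#)    ≈⟨ +-cong (1+× m 1#) (-‿cong (1+× n 1#)) ⟨
    suc m × 1# - suc n × 1#          ∎

  homomorphism : coefficients -Raw-AlmostCommutative⟶ fromCommutativeRing R
  homomorphism = record
    { ⟦_⟧    = ⟦_⟧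
    ; +-homo = λ (m , n) (m′ , n′) → begin
        ⟦ normalise (m Nat.+ m′) (n Nat.+ n′) ⟧  ≈⟨ ⟦normalise⟧ (m Nat.+ m′) (n Nat.+ n′) ⟩
        (m Nat.+ m′) × 1# - (n Nat.+ n′) × 1#    ≈⟨ +-cong (×-homo-+ 1# m m′) (-‿cong (×-homo-+ 1# n n′)) ⟩
        (m × 1# + m′ × 1#) - (n × 1# + n′ × 1#)  ≈⟨ [x+y]-[u+v] _ _ _ _ ⟩
        (m × 1# - n × 1#) + (m′ × 1# - n′ × 1#)  ≈⟨ +-cong (⟦,⟧ m n) (⟦,⟧ m′ n′) ⟨
        ⟦ m , n ⟧ + ⟦ m′ , n′ ⟧                  ∎
    ; *-homo = λ (m , n) (m′ , n′) → begin
        ⟦ normalise (m Nat.* m′ Nat.+ n Nat.* n′) (m Nat.* n′ Nat.+ n Nat.* m′) ⟧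
          ≈⟨ ⟦normalise⟧ (m Nat.* m′ Nat.+ n Nat.* n′) (m Nat.* n′ Nat.+ n Nat.* m′) ⟩
        (m Nat.* m′ Nat.+ n Nat.* n′) × 1# - (m Nat.* n′ Nat.+ n Nat.* m′) × 1#
          ≈⟨ +-cong (×-homo-+ 1# (m Nat.* m′) (n Nat.* n′)) (-‿cong (×-homo-+ 1# (m Nat.* n′) (n Nat.* m′))) ⟩
        ((m Nat.* m′) × 1# + (n Nat.* n′) × 1#) - ((m Nat.* n′) × 1# + (n Nat.* m′) × 1#)
          ≈⟨ +-cong (+-cong (×1-homo-* m m′) (×1-homo-* n n′)) (-‿cong (+-cong (×1-homo-* m n′) (×1-homo-* n m′))) ⟩
        (m × 1# * m′ × 1# + n × 1# * n′ × 1#) - (m × 1# * n′ × 1# + n × 1# * m′ × 1#)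
          ≈⟨ [x-y]*[u-v] _ _ _ _ ⟨
        (m × 1# - n × 1#) * (m′ × 1# - n′ × 1#)
          ≈⟨ *-cong (⟦,⟧ m n) (⟦,⟧ m′ n′) ⟨
        ⟦ m , n ⟧ * ⟦ m′ , n′ ⟧
          ∎
    ; -‿homo = λ (m , n) → begin
        ⟦ n , m ⟧            ≈⟨ ⟦,⟧ n m ⟩
        n × 1# - m × 1#      ≈⟨ ⁻¹-anti-homo‿- (m × 1#) (n × 1#) ⟨
        - (m × 1# - n × 1#)  ≈⟨ -‿cong (⟦,⟧ m n) ⟨
        - ⟦ m , n ⟧          ∎
    ; 0-homo = refl
    ; 1-homo = refl
    }

  open import Algebra.Solver.Ring coefficients (fromCommutativeRing R) homomorphism
    (λ x y → map (λ x≡y → reflexive (cong ⟦_⟧ x≡y)) (dec⇒weaklyDec (≡-dec Nat._≟_ Nat._≟_) x y)) public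
    using (solve; _:=_; _:+_; _:*_; _:-_; :-_; con; Polynomial)

  :1 : ∀ {n} → Polynomial n
  :1 = con (1 , 0)

triangular-suc : ∀ n → suc n Nat.* suc (suc n) Nat./ 2 ≡ n Nat.* suc n Nat./ 2 Nat.+ suc n
triangular-suc n = begin
  suc n Nat.* suc (suc n) Nat./ 2                    ≡⟨ cong (Nat._/ 2) (expand n) ⟩
  (n Nat.* suc n Nat.+ suc n Nat.* 2) Nat./ 2        ≡⟨ Nat.+-distrib-/-∣ʳ (n Nat.* suc n) (divides-refl (suc n)) ⟩
  n Nat.* suc n Nat./ 2 Nat.+ suc n Nat.* 2 Nat./ 2  ≡⟨ cong (n Nat.* suc n Nat./ 2 Nat.+_) (Nat.m*n/n≡m (suc n) 2) ⟩
  n Nat.* suc n Nat./ 2 Nat.+ suc n                  ∎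
  where
  open ≡.≡-Reasoning
  expand : ∀ n → suc n Nat.* suc (suc n) ≡ n Nat.* suc n Nat.+ suc n Nat.* 2
  expand = solve-∀

module FieldProperties {c ℓ} (F : Field c ℓ) where
  open Field F
  open import Algebra.Properties.CommutativeSemigroup *-commutativeSemigroup
    using (x∙yz≈yx∙z; x∙yz≈y∙xz)
  open import Relation.Binary.Reasoning.Setoid setoid

  y*x≈z⇒x≈z/y : ∀ {x y z} → ¬ y ≈ 0# → y * x ≈ z → x ≈ z / y
  y*x≈z⇒x≈z/y {x} {y} {z} y≉0 yx≈z = begin
    x               ≈⟨ *-identityʳ x ⟨
    x * 1#          ≈⟨ *-congˡ (inverseʳ y y≉0) ⟨
    x * (y * y ⁻¹)  ≈⟨ x∙yz≈yx∙z x y (y ⁻¹) ⟩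
    y * x * y ⁻¹    ≈⟨ *-congʳ yx≈z ⟩
    z / y           ∎

  *-cancelˡ : ∀ {x y z} → ¬ x ≈ 0# → x * y ≈ x * z → y ≈ z
  *-cancelˡ x≉0 xy≈xz = trans (y*x≈z⇒x≈z/y x≉0 xy≈xz) (sym (y*x≈z⇒x≈z/y x≉0 refl))

  *≉0 : ∀ {x y} → ¬ x ≈ 0# → ¬ y ≈ 0# → ¬ x * y ≈ 0#
  *≉0 {x} {y} x≉0 y≉0 xy≈0 = x≉0 (begin
    x            ≈⟨ y*x≈z⇒x≈z/y y≉0 (*-comm y x) ⟩
    x * y / y    ≈⟨ *-congʳ xy≈0 ⟩
    0# * y ⁻¹    ≈⟨ zeroˡ (y ⁻¹) ⟩
    0#           ∎)

  x/y*y≈x : ∀ {x y} → ¬ y ≈ 0# → x / y * y ≈ x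
  x/y*y≈x {x} {y} y≉0 = begin
    x * y ⁻¹ * y    ≈⟨ *-assoc x (y ⁻¹) y ⟩
    x * (y ⁻¹ * y)  ≈⟨ *-congˡ (*-comm (y ⁻¹) y) ⟩
    x * (y * y ⁻¹)  ≈⟨ *-congˡ (inverseʳ y y≉0) ⟩
    x * 1#          ≈⟨ *-identityʳ x ⟩
    x               ∎

  y*x/[y*w]*w≈x : ∀ {x y w} → ¬ y ≈ 0# → ¬ w ≈ 0# → y * x / (y * w) * w ≈ x
  y*x/[y*w]*w≈x {x} {y} {w} y≉0 w≉0 = *-cancelˡ y≉0 (begin
    y * (y * x / (y * w) * w)  ≈⟨ x∙yz≈y∙xz y _ w ⟩
    y * x / (y * w) * (y * w)  ≈⟨ x/y*y≈x (*≉0 y≉0 w≉0) ⟩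
    y * x                      ∎)

module QSeries {c ℓ} (F : Field c ℓ) where
  open Field F
  open QDefs F
  open FieldProperties F
  open IntegerCoefficientRingSolver commutativeRing
  open import Algebra.Properties.CommutativeSemigroup *-commutativeSemigroup
    using (x∙yz≈y∙xz; x∙yz≈y∙zx; x∙yz≈xz∙y; xy∙z≈xz∙y)
  open import Algebra.Properties.CommutativeSemigroup +-commutativeSemigroup
    using () renaming (interchange to +-interchange)
  open import Relation.Binary.Reasoning.Setoid setoid

  pow-+ : ∀ x m n → pow x (m Nat.+ n) ≈ pow x m * pow x n
  pow-+ x zero    n = sym (*-identityˡ (pow x n))
  pow-+ x (suc m) n = trans (*-congʳ (pow-+ x m n)) (xy∙z≈xz∙y (pow x m) (pow x n) x)

  pow-∸-+ : ∀ x {m n} → m ≤ n → pow x (n ∸ m) * pow x m ≈ pow x n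
  pow-∸-+ x {m} {n} m≤n = trans (sym (pow-+ x (n ∸ m) m)) (reflexive (cong (pow x) (m∸n+n≡m m≤n)))

  sum1-cong : ∀ N {f g : ℕ → Carrier} → (∀ k → k < N → f (suc k) ≈ g (suc k)) → sum1 N f ≈ sum1 N g
  sum1-cong zero    _     = refl
  sum1-cong (suc N) f≈g = +-cong (sum1-cong N λ k k<N → f≈g k (m≤n⇒m≤1+n k<N)) (f≈g N ≤-refl)

  sum1-+ : ∀ N (f g : ℕ → Carrier) → sum1 N (λ n → f n + g n) ≈ sum1 N f + sum1 N g
  sum1-+ zero    f g = sym (+-identityʳ 0#)
  sum1-+ (suc N) f g = trans (+-congʳ (sum1-+ N f g)) (+-interchange _ _ _ _)

  sum1-telescope : ∀ N (s f : ℕ → Carrier) → s 0 ≈ 0# →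
                   (∀ n → n < N → s (suc n) ≈ s n + f (suc n)) → s N ≈ sum1 N f
  sum1-telescope zero    s f s0≈0 step = s0≈0
  sum1-telescope (suc N) s f s0≈0 step =
    trans (step N ≤-refl) (+-congʳ (sum1-telescope N s f s0≈0 λ n n<N → step n (m≤n⇒m≤1+n n<N)))

  NonzeroOn : (ℕ → Carrier) → ℕ → Set ℓ
  NonzeroOn f N = ∀ n → 1 ≤ n → n ≤ N → ¬ f n ≈ 0#

  NonzeroOn-mono : ∀ {f M N} → M ≤ N → NonzeroOn f N → NonzeroOn f M
  NonzeroOn-mono M≤N f≉0 n 1≤n n≤M = f≉0 n 1≤n (≤-trans n≤M M≤N)

  module QFalling (q : Carrier) where

    -- qfalling N n = (1 - q^N)(1 - q^(N-1))⋯(1 - q^(N-n+1)) = [N n] (q)_n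
    qfalling : ℕ → ℕ → Carrier
    qfalling N zero    = 1#
    qfalling N (suc n) = qfalling N n * (1# - pow q (N ∸ n))

    poch-pred : ∀ {m n} → m ≡ suc n → poch q q m ≈ poch q q n * (1# - pow q m)
    poch-pred {n = n} ≡.refl = *-congˡ (+-congˡ (-‿cong (*-comm q (pow q n))))

    poch≉0 : ∀ {N} → NonzeroOn (λ n → 1# - pow q n) N → ¬ poch q q N ≈ 0#
    poch≉0 {zero}  _ = 1≉0
    poch≉0 {suc N} e≉0 p≈0 =
      *≉0 (poch≉0 (NonzeroOn-mono (n≤1+n N) e≉0)) (e≉0 (suc N) (s≤s z≤n) ≤-refl) (trans (sym (poch-pred {n = N} ≡.refl)) p≈0)

    poch≈qfalling*poch : ∀ {N} n → n ≤ N → poch q q N ≈ qfalling N n * poch q q (N ∸ n)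
    poch≈qfalling*poch zero    _   = sym (*-identityˡ _)
    poch≈qfalling*poch {N} (suc n) n<N = begin
      poch q q N                                                     ≈⟨ poch≈qfalling*poch n (<⇒≤ n<N) ⟩
      qfalling N n * poch q q (N ∸ n)                                ≈⟨ *-congˡ (poch-pred (+-∸-assoc 1 n<N)) ⟩
      qfalling N n * (poch q q (N ∸ suc n) * (1# - pow q (N ∸ n)))   ≈⟨ x∙yz≈xz∙y _ _ _ ⟩
      qfalling N (suc n) * poch q q (N ∸ suc n)                      ∎

    qbinom≈ : ∀ {N n} → n ≤ N → qbinom q N n ≈ poch q q N / (poch q q n * poch q q (N ∸ n))
    qbinom≈ {N} {n} n≤N with n Nat.≤? N
    ... | yes _   = refl
    ... | no  n≰N = contradiction n≤N n≰N

    qbinom*poch≈qfalling : ∀ {N n} → NonzeroOn (λ n → 1# - pow q n) N → n ≤ N →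
                           qbinom q N n * poch q q n ≈ qfalling N n
    qbinom*poch≈qfalling {N} {n} e≉0 n≤N = *-cancelˡ r≉0 (begin
      r * (qbinom q N n * p)          ≈⟨ x∙yz≈y∙zx r _ p ⟩
      qbinom q N n * (p * r)          ≈⟨ *-congʳ (qbinom≈ n≤N) ⟩
      poch q q N / (p * r) * (p * r)  ≈⟨ x/y*y≈x (*≉0 (poch≉0 (NonzeroOn-mono n≤N e≉0)) r≉0) ⟩
      poch q q N                      ≈⟨ poch≈qfalling*poch n n≤N ⟩
      qfalling N n * r                ≈⟨ *-comm _ r ⟩
      r * qfalling N n                ∎)
      where
      p = poch q q n
      r = poch q q (N ∸ n)
      r≉0 : ¬ r ≈ 0#
      r≉0 = poch≉0 (NonzeroOn-mono (m∸n≤m N n) e≉0)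

    qfalling-suc : ∀ N k → qfalling (suc N) (suc k) ≈ (1# - pow q (suc N)) * qfalling N k
    qfalling-suc N zero    = *-comm 1# _
    qfalling-suc N (suc k) = trans (*-congʳ (qfalling-suc N k)) (*-assoc _ _ _)

    qfalling-pascal : ∀ {N k} → k ≤ N → qfalling (suc N) (suc k)
                      ≈ qfalling N (suc k) + (1# - pow q (suc k)) * (pow q (N ∸ k) * qfalling N k)
    qfalling-pascal {N} {k} k≤N = begin
      qfalling (suc N) (suc k)                               ≈⟨ qfalling-suc N k ⟩
      (1# - pow q (suc N)) * qfalling N k                    ≈⟨ *-congʳ (+-congˡ (-‿cong (pow-∸-+ q (s≤s k≤N)))) ⟨
      (1# - pow q (N ∸ k) * pow q (suc k)) * qfalling N k    ≈⟨ pascal _ _ _ ⟩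
      qfalling N (suc k) + (1# - pow q (suc k)) * (pow q (N ∸ k) * qfalling N k) ∎
      where
      pascal : ∀ z y P → (1# - z * y) * P ≈ P * (1# - z) + (1# - y) * (z * P)
      pascal = solve 3 (λ z y P → (:1 :- z :* y) :* P := P :* (:1 :- z) :+ (:1 :- y) :* (z :* P)) refl

    qfalling-vanishes : ∀ N → qfalling N (suc N) ≈ 0#
    qfalling-vanishes N = begin
      qfalling N N * (1# - pow q (N ∸ N))  ≈⟨ *-congˡ (+-congˡ (-‿cong (reflexive (cong (pow q) (n∸n≡0 N))))) ⟩
      qfalling N N * (1# - 1#)             ≈⟨ *-congˡ (-‿inverseʳ 1#) ⟩
      qfalling N N * 0#                    ≈⟨ zeroʳ _ ⟩
      0#                                   ∎

  module Summands (a q : Carrier) where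
    open QFalling q

    weight : ℕ → Carrier
    weight n = pow (- 1#) (n ∸ 1) * pow a n * pow q (tri n)

    lhsTerm : ℕ → ℕ → Carrier
    lhsTerm N n = weight n * qfalling N n / ((1# - pow q n) * poch (a * q) q n)

    -- The second summand of qfalling-pascal, kept over the denominator of lhsTerm so that the
    -- Pascal step needs no cancellation; the value at 0 is never used by sum1.
    pascalTerm : ℕ → ℕ → Carrier
    pascalTerm N zero    = 0#
    pascalTerm N (suc k) = (1# - pow q (suc k)) * (weight (suc k) * (pow q (N ∸ k) * qfalling N k))
                           / ((1# - pow q (suc k)) * poch (a * q) q (suc k))

    rhsTerm : ℕ → Carrier
    rhsTerm n = a * pow q n / (1# - a * pow q n)

    weight-suc : ∀ k → weight (suc (suc k)) ≈ weight (suc k) * - (a * pow q (suc (suc k)))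
    weight-suc k = begin
      pow (- 1#) (suc k) * pow a (suc (suc k)) * pow q (tri (suc (suc k)))
        ≈⟨ *-congˡ (trans (reflexive (cong (pow q) (triangular-suc (suc k)))) (pow-+ q (tri (suc k)) (suc (suc k)))) ⟩
      pow (- 1#) k * - 1# * (pow a (suc k) * a) * (pow q (tri (suc k)) * pow q (suc (suc k)))
        ≈⟨ regroup _ _ _ _ _ ⟩
      weight (suc k) * - (a * pow q (suc (suc k))) ∎
      where
      regroup : ∀ s α τ x y → s * - 1# * (α * x) * (τ * y) ≈ s * α * τ * - (x * y)
      regroup = solve 5 (λ s α τ x y → s :* (:- :1) :* (α :* x) :* (τ :* y) := s :* α :* τ :* (:- (x :* y))) refl

    lhsTerm-pascal : ∀ {N k} → k ≤ N → lhsTerm (suc N) (suc k) ≈ lhsTerm N (suc k) + pascalTerm N (suc k)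
    lhsTerm-pascal {N} {k} k≤N = begin
      W * qfalling (suc N) (suc k) / E            ≈⟨ *-congʳ (*-congˡ (qfalling-pascal k≤N)) ⟩
      W * (qfalling N (suc k) + e * Y) / E        ≈⟨ *-congʳ (distribˡ W _ _) ⟩
      (W * qfalling N (suc k) + W * (e * Y)) / E  ≈⟨ *-congʳ (+-congˡ (x∙yz≈y∙xz W e Y)) ⟩
      (W * qfalling N (suc k) + e * (W * Y)) / E  ≈⟨ distribʳ (E ⁻¹) _ _ ⟩
      lhsTerm N (suc k) + pascalTerm N (suc k)    ∎
      where
      W = weight (suc k)
      e = 1# - pow q (suc k)
      Y = pow q (N ∸ k) * qfalling N k
      E = e * poch (a * q) q (suc k)

    lhsTerm-vanishes : ∀ N → lhsTerm N (suc N) ≈ 0#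
    lhsTerm-vanishes N = trans (*-congʳ (trans (*-congˡ (qfalling-vanishes N)) (zeroʳ _))) (zeroˡ _)

    pascalTerm*poch : ∀ N k → ¬ 1# - pow q (suc k) ≈ 0# → ¬ poch (a * q) q (suc k) ≈ 0# →
                      pascalTerm N (suc k) * poch (a * q) q (suc k) ≈ weight (suc k) * (pow q (N ∸ k) * qfalling N k)
    pascalTerm*poch N k = y*x/[y*w]*w≈x

    partialSum-step : ∀ {Q} y z A W P → Q ≈ z * (y * q) →
      (1# - a * q * y) * (a * Q * (A + W * P)) + (1# - a * Q) * (W * - (a * (y * q)) * (z * P))
        ≈ a * Q * (A * (1# - a * q * y) + W * - (a * (y * q)) * (P * (1# - z)))
    partialSum-step {Q} y z A W P Q≈zyq = begin
      γ * (a * Q * (A + W * P)) + (1# - a * Q) * (W * m * (z * P))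
        ≈⟨ +-cong (*-congˡ (*-congʳ (*-congˡ Q≈zyq))) (*-congʳ (+-congˡ (-‿cong (*-congˡ Q≈zyq)))) ⟩
      γ * (a * (z * (y * q)) * (A + W * P)) + (1# - a * (z * (y * q))) * (W * m * (z * P))
        ≈⟨ identity a q y z A W P ⟩
      a * (z * (y * q)) * (A * γ + W * m * (P * (1# - z)))
        ≈⟨ *-congʳ (*-congˡ Q≈zyq) ⟨
      a * Q * (A * γ + W * m * (P * (1# - z))) ∎
      where
      γ = 1# - a * q * y
      m = - (a * (y * q))
      identity : ∀ a q y z A W P →
        (1# - a * q * y) * (a * (z * (y * q)) * (A + W * P)) + (1# - a * (z * (y * q))) * (W * - (a * (y * q)) * (z * P))
          ≈ a * (z * (y * q)) * (A * (1# - a * q * y) + W * - (a * (y * q)) * (P * (1# - z)))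
      identity = solve 7 (λ a q y z A W P →
        (:1 :- a :* q :* y) :* (a :* (z :* (y :* q)) :* (A :+ W :* P)) :+ (:1 :- a :* (z :* (y :* q))) :* (W :* (:- (a :* (y :* q))) :* (z :* P))
          := a :* (z :* (y :* q)) :* (A :* (:1 :- a :* q :* y) :+ W :* (:- (a :* (y :* q))) :* (P :* (:1 :- z)))) refl

    pascalTerm-partialSum : ∀ {N k} → k ≤ N →
      NonzeroOn (λ n → 1# - pow q n) (suc N) → NonzeroOn (poch (a * q) q) (suc N) →
      poch (a * q) q (suc k) * ((1# - a * pow q (suc N)) * sum1 (suc k) (pascalTerm N))
        ≈ a * pow q (suc N) * (poch (a * q) q (suc k) + weight (suc k) * qfalling N (suc k))
    pascalTerm-partialSum {N} {zero} _ e≉0 A≉0 = begin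
      A₁ * (u * (0# + pascalTerm N 1))   ≈⟨ *-congˡ (*-congˡ (+-identityˡ _)) ⟩
      A₁ * (u * pascalTerm N 1)          ≈⟨ x∙yz≈y∙zx A₁ u _ ⟩
      u * (pascalTerm N 1 * A₁)          ≈⟨ *-congˡ (pascalTerm*poch N 0 (e≉0 1 ≤-refl (s≤s z≤n)) (A≉0 1 ≤-refl (s≤s z≤n))) ⟩
      u * (weight 1 * (pow q N * 1#))    ≈⟨ base a q (pow q N) ⟩
      a * pow q (suc N) * (A₁ + weight 1 * qfalling N 1) ∎
      where
      A₁ = poch (a * q) q 1
      u = 1# - a * pow q (suc N)
      -- weight 1, poch (a * q) q 1 and qfalling N 1 unfold to these products with 1#.
      base : ∀ a q x → (1# - a * (x * q)) * (1# * (1# * a) * (1# * q) * (x * 1#))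
             ≈ a * (x * q) * (1# * (1# - a * q * 1#) + 1# * (1# * a) * (1# * q) * (1# * (1# - x)))
      base = solve 3 (λ a q x → (:1 :- a :* (x :* q)) :* (:1 :* (:1 :* a) :* (:1 :* q) :* (x :* :1))
                               := a :* (x :* q) :* (:1 :* (:1 :- a :* q :* :1) :+ :1 :* (:1 :* a) :* (:1 :* q) :* (:1 :* (:1 :- x)))) refl
    pascalTerm-partialSum {N} {suc k} k<N e≉0 A≉0 = begin
      A₁ * γ * (u * (sum1 (suc k) (pascalTerm N) + pascalTerm N (suc (suc k))))
        ≈⟨ distribute A₁ γ u _ _ ⟩
      γ * (A₁ * (u * sum1 (suc k) (pascalTerm N))) + u * (pascalTerm N (suc (suc k)) * (A₁ * γ))
        ≈⟨ +-cong (*-congˡ (pascalTerm-partialSum (<⇒≤ k<N) e≉0 A≉0))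
                  (*-congˡ (pascalTerm*poch N (suc k) (e≉0 (suc (suc k)) (s≤s z≤n) (s≤s k<N)) (A≉0 (suc (suc k)) (s≤s z≤n) (s≤s k<N)))) ⟩
      γ * (a * Q * (A₁ + W₁ * P)) + u * (weight (suc (suc k)) * (z * P))
        ≈⟨ +-congˡ (*-congˡ (*-congʳ (weight-suc k))) ⟩
      γ * (a * Q * (A₁ + W₁ * P)) + u * (W₁ * - (a * (y * q)) * (z * P))
        ≈⟨ partialSum-step y z A₁ W₁ P hQ ⟩
      a * Q * (A₁ * γ + W₁ * - (a * (y * q)) * (P * (1# - z)))
        ≈⟨ *-congˡ (+-congˡ (*-congʳ (weight-suc k))) ⟨
      a * Q * (A₁ * γ + weight (suc (suc k)) * qfalling N (suc (suc k))) ∎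
      where
      A₁ = poch (a * q) q (suc k)
      W₁ = weight (suc k)
      P = qfalling N (suc k)
      Q = pow q (suc N)
      y = pow q (suc k)
      z = pow q (N ∸ suc k)
      γ = 1# - a * q * y
      u = 1# - a * Q
      hQ : Q ≈ z * (y * q)
      hQ = sym (pow-∸-+ q (s≤s k<N))
      distribute : ∀ A γ u S D → A * γ * (u * (S + D)) ≈ γ * (A * (u * S)) + u * (D * (A * γ))
      distribute = solve 5 (λ A γ u S D → A :* γ :* (u :* (S :+ D)) := γ :* (A :* (u :* S)) :+ u :* (D :* (A :* γ))) refl

    pascalTerm-sum : ∀ {N} → NonzeroOn (λ n → 1# - pow q n) (suc N) → NonzeroOn (poch (a * q) q) (suc N) →
                     ¬ 1# - a * pow q (suc N) ≈ 0# → sum1 (suc N) (pascalTerm N) ≈ rhsTerm (suc N)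
    pascalTerm-sum {N} e≉0 A≉0 d≉0 = y*x≈z⇒x≈z/y d≉0 (*-cancelˡ (A≉0 (suc N) (s≤s z≤n) ≤-refl) (begin
      A * ((1# - a * Q) * sum1 (suc N) (pascalTerm N))  ≈⟨ pascalTerm-partialSum ≤-refl e≉0 A≉0 ⟩
      a * Q * (A + weight (suc N) * qfalling N (suc N))  ≈⟨ *-congˡ (+-congˡ (*-congˡ (qfalling-vanishes N))) ⟩
      a * Q * (A + weight (suc N) * 0#)                  ≈⟨ *-congˡ (trans (+-congˡ (zeroʳ _)) (+-identityʳ A)) ⟩
      a * Q * A                                          ≈⟨ *-comm _ A ⟩
      A * (a * Q)                                        ∎))
      where
      A = poch (a * q) q (suc N)
      Q = pow q (suc N)

    lhsTerm-sum-suc : ∀ {N} → NonzeroOn (λ n → 1# - pow q n) (suc N) → NonzeroOn (poch (a * q) q) (suc N) →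
                      ¬ 1# - a * pow q (suc N) ≈ 0# →
                      sum1 (suc N) (lhsTerm (suc N)) ≈ sum1 N (lhsTerm N) + rhsTerm (suc N)
    lhsTerm-sum-suc {N} e≉0 A≉0 d≉0 = begin
      sum1 (suc N) (lhsTerm (suc N))
        ≈⟨ sum1-cong (suc N) (λ k k<1+N → lhsTerm-pascal (s≤s⁻¹ k<1+N)) ⟩
      sum1 (suc N) (λ n → lhsTerm N n + pascalTerm N n)
        ≈⟨ sum1-+ (suc N) (lhsTerm N) (pascalTerm N) ⟩
      sum1 N (lhsTerm N) + lhsTerm N (suc N) + sum1 (suc N) (pascalTerm N)
        ≈⟨ +-cong (trans (+-congˡ (lhsTerm-vanishes N)) (+-identityʳ _)) (pascalTerm-sum e≉0 A≉0 d≉0) ⟩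
      sum1 N (lhsTerm N) + rhsTerm (suc N) ∎

    lhsTerm-sum : ∀ N → NonzeroOn (λ n → 1# - pow q n) N → NonzeroOn (poch (a * q) q) N →
                  NonzeroOn (λ n → 1# - a * pow q n) N → sum1 N (lhsTerm N) ≈ sum1 N rhsTerm
    lhsTerm-sum N e≉0 A≉0 d≉0 = sum1-telescope N (λ n → sum1 n (lhsTerm n)) rhsTerm refl λ n n<N →
      lhsTerm-sum-suc (NonzeroOn-mono n<N e≉0) (NonzeroOn-mono n<N A≉0) (d≉0 (suc n) (s≤s z≤n) n<N)

    summand≈lhsTerm : ∀ {N n} → NonzeroOn (λ n → 1# - pow q n) N → n ≤ N →
      qbinom q N n * (weight n * poch q q n / ((1# - pow q n) * poch (a * q) q n)) ≈ lhsTerm N n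
    summand≈lhsTerm {N} {n} e≉0 n≤N = begin
      qbinom q N n * (weight n * poch q q n * E ⁻¹)  ≈⟨ *-assoc _ _ _ ⟨
      qbinom q N n * (weight n * poch q q n) * E ⁻¹  ≈⟨ *-congʳ (x∙yz≈y∙xz _ _ _) ⟩
      weight n * (qbinom q N n * poch q q n) * E ⁻¹  ≈⟨ *-congʳ (*-congˡ (qbinom*poch≈qfalling e≉0 n≤N)) ⟩
      lhsTerm N n                                    ∎
      where
      E = (1# - pow q n) * poch (a * q) q n

theorem3p4 : ∀ {c ℓ : Level} (F : Field c ℓ) →
    let open Field F
        open QDefs F
    in (N : ℕ) (a q : Carrier) →
       (∀ n → 1 ≤ n → n ≤ N → ¬ (1# - pow q n ≈ 0#)) →
       (∀ n → n ≤ N → ¬ (poch (a * q) q n ≈ 0#)) →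
       (∀ n → 1 ≤ n → n ≤ N → ¬ (1# - a * pow q n ≈ 0#)) →
       sum1 N (λ n → qbinom q N n
                     * ((pow (- 1#) (n ∸ 1) * pow a n * pow q (tri n) * poch q q n)
                        / ((1# - pow q n) * poch (a * q) q n)))
       ≈ sum1 N (λ n → (a * pow q n) / (1# - a * pow q n))
theorem3p4 F N a q e≉0 A≉0 d≉0 =
  trans (sum1-cong N λ k k<N → summand≈lhsTerm e≉0 k<N)
        (lhsTerm-sum N e≉0 (λ n _ → A≉0 n) d≉0)
  where
  open Field F
  open QSeries F
  open Summands a q
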